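{- Let $\rho$ be a right corner from $x_i^{(k)}$ to $x_j^{(k)}$ and let $1\le d\le e$, where $e$ is the extent of $\rho$. Then $\rho$ has a subpath $\rho'$ from $x_i^{(k)}$ to $x_p^{(k+d)}$ for some $1\le p\le N$ such that $\mathrm{positions}(\rho')=\{k,\dots,k+d\}$.
   Context: Let $R(\mathbf{x},\mathbf{x}')$ be a difference bounds constraint over $\mathbf{x}=\{x_1,\dots,x_N\}$ (a finite conjunction of atoms $u-v\le c$, $c\in\mathbb{Z}$, with constraint graph having an edge $u\xrightarrow{c}v$ per atom). With fresh copies $x_i^{(p)}$, $p\in\mathbb{Z}$ (position $p$), the bi-infinite unfolding is the union over all $p$ of the constraint graphs of $R(\mathbf{x}^{(p)},\mathbf{x}^{(p+1)})$; all paths are in it, subpaths are contiguous, and $\mathrm{positions}(\rho)$ is the set of positions of vertices of $\rho$. A right corner of extent $e$ is a path with at least one edge whose first and last vertex are at position $k_0$ and whose set of positions is $\{k_0,\dots,k_0+e\}$. -}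

module Defs where

open import Data.Nat using (ℕ)
open import Data.Fin using (Fin)
open import Data.Integer using (ℤ; _+_; _≤_; +_)
open import Data.Product using (Σ; _×_; _,_; proj₂)
open import Data.Sum using (_⊎_; inj₁; inj₂)
open import Data.List using (List)
open import Data.List.Membership.Propositional using (_∈_)
open import Relation.Binary.PropositionalEquality using (_≡_)
open import Function.Bundles using (_⇔_)

-- Variables of R(x, x'): inj₁ i is x_i (unprimed), inj₂ i is x'_i (primed).
Var : ℕ → Set
Var N = Fin N ⊎ Fin N

-- An atom  u - v ≤ c
record Atom (N : ℕ) : Set where
  constructor atom
  field
    u : Var N
    v : Var N
    c : ℤ

-- A difference bounds constraint: a finite conjunction of atoms.
DBC : ℕ → Set
DBC N = List (Atom N)

-- Vertices of the bi-infinite unfolding: x_i^(p) is (i , p).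
Vertex : ℕ → Set
Vertex N = Fin N × ℤ

position : ∀ {N} → Vertex N → ℤ
position = proj₂

-- The copy of a variable in R(x^(p), x^(p+1)).
place : ∀ {N} → ℤ → Var N → Vertex N
place p (inj₁ i) = i , p
place p (inj₂ i) = i , p + + 1

-- An edge a → b of the unfolding: comes from an atom u - v ≤ c of R
-- instantiated at some position p (edge u^(p) -c-> v^(p)).
Edge : ∀ {N} → DBC N → Vertex N → Vertex N → Set
Edge {N} R a b =
  Σ (Atom N) λ t → t ∈ R × Σ ℤ λ p → place p (Atom.u t) ≡ a × place p (Atom.v t) ≡ b

data Path {N} (R : DBC N) : Vertex N → Vertex N → Set where
  [_]   : (a : Vertex N) → Path R a a
  _∷⟨_⟩_ : ∀ {b c} (a : Vertex N) → Edge R a b → Path R b c → Path R a c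

infixr 5 _∷⟨_⟩_

len : ∀ {N} {R : DBC N} {a b} → Path R a b → ℕ
len [ a ] = 0
len (a ∷⟨ e ⟩ ρ) = Data.Nat.suc (len ρ)

data OnPath {N} {R : DBC N} (x : Vertex N) : ∀ {a b} → Path R a b → Set where
  here-[] : OnPath x [ x ]
  here-∷  : ∀ {b c} {e : Edge R x b} {ρ : Path R b c} → OnPath x (x ∷⟨ e ⟩ ρ)
  there   : ∀ {a b c} {e : Edge R a b} {ρ : Path R b c} → OnPath x ρ → OnPath x (a ∷⟨ e ⟩ ρ)

InPositions : ∀ {N} {R : DBC N} {a b} → Path R a b → ℤ → Set
InPositions {N} ρ q = Σ (Vertex N) λ x → OnPath x ρ × position x ≡ q

PositionsAre : ∀ {N} {R : DBC N} {a b} → Path R a b → ℤ → ℤ → Set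
PositionsAre ρ lo hi = ∀ q → InPositions ρ q ⇔ (lo ≤ q × q ≤ hi)

-- Contiguous subpaths: a prefix of a suffix.
data Prefix {N} {R : DBC N} : ∀ {a b c} → Path R a b → Path R a c → Set where
  pre-[] : ∀ {a c} {ρ : Path R a c} → Prefix [ a ] ρ
  pre-∷  : ∀ {a b b' c} {e : Edge R a b} {ρ' : Path R b b'} {ρ : Path R b c} →
           Prefix ρ' ρ → Prefix (a ∷⟨ e ⟩ ρ') (a ∷⟨ e ⟩ ρ)

data Suffix {N} {R : DBC N} : ∀ {a b c} → Path R b c → Path R a c → Set where
  suf-refl : ∀ {a c} {ρ : Path R a c} → Suffix ρ ρ
  suf-∷    : ∀ {a a' b c} {e : Edge R a a'} {σ : Path R b c} {ρ : Path R a' c} →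
             Suffix σ ρ → Suffix σ (a ∷⟨ e ⟩ ρ)

Subpath : ∀ {N} {R : DBC N} {a b a' b'} → Path R a' b' → Path R a b → Set
Subpath {N} {R} {a} {b} {a'} ρ' ρ = Σ (Path R a' b) λ σ → Suffix σ ρ × Prefix ρ' σ

IsRightCorner : ∀ {N} {R : DBC N} {a b} → Path R a b → ℕ → Set
IsRightCorner {a = a} {b} ρ e =
  1 Data.Nat.≤ len ρ × position a ≡ position b × PositionsAre ρ (position a) (position a + + e)

module Submission where

-- Every edge of the unfolding comes from an atom of
-- R(x^(p), x^(p+1)), so along an edge the position rises by at most one.
-- Two consequences give the theorem:
--   * (discrete intermediate values) a path from a to b passes through every
--     position between position a and position b;
--   * (first arrival) if a path starting at or below position t visits
--     position t, then its prefix ending at the first such visit stays at or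
--     below t.
-- For a right corner ρ at position k of extent e ≥ d, position k + d is
-- visited by ρ; the first-arrival prefix ρ' is the required subpath.  Its
-- positions lie above k because ρ' lies on ρ, below k + d by construction,
-- and cover {k, …, k + d} by the intermediate value property.

open import Defs
open import Data.Nat using (ℕ; _≤_)
open import Data.Fin using (Fin)
open import Data.Integer using (ℤ; _+_; +_)
open import Data.Product using (Σ; _×_; _,_; proj₁)
open import Data.Sum using (inj₁; inj₂)
open import Data.Empty using (⊥-elim)
open import Relation.Nullary using (yes; no)
open import Relation.Binary.PropositionalEquality using (_≡_; refl)
open import Function.Bundles using (mk⇔; Equivalence)
import Data.Integer as Z
import Data.Integer.Properties as ZP

place-above : ∀ {N} p (v : Var N) → p Z.≤ position (place p v)
place-above p (inj₁ i) = ZP.≤-refl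
place-above p (inj₂ i) = ZP.i≤i+j p (+ 1)

place-below : ∀ {N} p (v : Var N) → position (place p v) Z.≤ Z.suc p
place-below p (inj₁ i) = ZP.i≤suc[i] p
place-below p (inj₂ i) = ZP.≤-reflexive (ZP.+-comm p (+ 1))

edge-step : ∀ {N} {R : DBC N} {a b} → Edge R a b → position b Z.≤ Z.suc (position a)
edge-step (t , _ , p , refl , refl) =
  ZP.≤-trans (place-below p (Atom.v t)) (ZP.suc-mono (place-above p (Atom.u t)))

edge-step-below : ∀ {N} {R : DBC N} {a b} (q : ℤ) → Edge R a b →
  position a Z.< q → position b Z.≤ q
edge-step-below q ed a<q = ZP.≤-trans (edge-step ed) (ZP.i<j⇒suc[i]≤j a<q)

onPath-start : ∀ {N} {R : DBC N} {a c} (ρ : Path R a c) → OnPath a ρ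
onPath-start [ _ ] = here-[]
onPath-start (_ ∷⟨ _ ⟩ _) = here-∷

onPath-prefix : ∀ {N} {R : DBC N} {a b c} {ρ' : Path R a b} {ρ : Path R a c} {x} →
  Prefix ρ' ρ → OnPath x ρ' → OnPath x ρ
onPath-prefix pre-[] here-[] = onPath-start _
onPath-prefix (pre-∷ pr) here-∷ = here-∷
onPath-prefix (pre-∷ pr) (there o) = there (onPath-prefix pr o)

intermediate-positions : ∀ {N} {R : DBC N} {a b} (ρ : Path R a b) (q : ℤ) →
  position a Z.≤ q → q Z.≤ position b → InPositions ρ q
intermediate-positions [ a ] q a≤q q≤a = a , here-[] , ZP.≤-antisym a≤q q≤a
intermediate-positions (a ∷⟨ ed ⟩ ρ) q a≤q q≤b with position a ZP.≟ q
... | yes a≡q = a , here-∷ , a≡q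
... | no a≢q with intermediate-positions ρ q
                   (edge-step-below q ed (ZP.≤∧≢⇒< a≤q a≢q)) q≤b
...   | y , o , y≡q = y , there o , y≡q

first-arrival : ∀ {N} {R : DBC N} {a c} (ρ : Path R a c) (t : ℤ) →
  position a Z.≤ t → (x : Vertex N) → OnPath x ρ → position x ≡ t →
  Σ (Fin N) λ p → Σ (Path R a (p , t)) λ ρ' →
    Prefix ρ' ρ × (∀ y → OnPath y ρ' → position y Z.≤ t)
first-arrival {a = a₁ , a₂} ρ t a≤t x o x≡t with a₂ ZP.≟ t
... | yes refl = a₁ , [ a₁ , a₂ ] , pre-[] , λ { y here-[] → ZP.≤-refl }
first-arrival [ _ ] t a≤t x here-[] x≡t | no a≢t = ⊥-elim (a≢t x≡t)
first-arrival (_ ∷⟨ _ ⟩ _) t a≤t x here-∷ x≡t | no a≢t = ⊥-elim (a≢t x≡t)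
first-arrival {a = a} (_ ∷⟨ ed ⟩ ρ) t a≤t x (there o) x≡t | no a≢t
  with first-arrival ρ t (edge-step-below t ed (ZP.≤∧≢⇒< a≤t a≢t)) x o x≡t
... | p , ρ' , pr , below = p , (a ∷⟨ ed ⟩ ρ') , pre-∷ pr , below'
  where
  below' : ∀ y → OnPath y (a ∷⟨ ed ⟩ ρ') → position y Z.≤ t
  below' y here-∷ = a≤t
  below' y (there oy) = below y oy

proposition14 : ∀ (N : ℕ) (R : DBC N) (i j : Fin N) (k : ℤ) (ρ : Path R (i , k) (j , k))
    (e : ℕ) → IsRightCorner ρ e → (d : ℕ) → 1 ≤ d → d ≤ e →
    Σ (Fin N) λ p → Σ (Path R (i , k) (p , k + + d)) λ ρ' →
    Subpath ρ' ρ × PositionsAre ρ' k (k + + d)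
proposition14 N R i j k ρ e (_ , _ , positions-ρ) d _ d≤e
  with Equivalence.from (positions-ρ (k + + d))
         (ZP.i≤i+j k (+ d) , ZP.+-monoʳ-≤ k (Z.+≤+ d≤e))
... | x , x∈ρ , x≡k+d with first-arrival ρ (k + + d) (ZP.i≤i+j k (+ d)) x x∈ρ x≡k+d
... | p , ρ' , ρ'≼ρ , below =
  p , ρ' , (ρ , suf-refl , ρ'≼ρ) , λ q → mk⇔
    (λ { (y , y∈ρ' , refl) → above y y∈ρ' , below y y∈ρ' })
    (λ { (k≤q , q≤k+d) → intermediate-positions ρ' q k≤q q≤k+d })
  where
  above : ∀ y → OnPath y ρ' → k Z.≤ position y
  above y y∈ρ' = proj₁ (Equivalence.to (positions-ρ (position y))
                          (y , onPath-prefix ρ'≼ρ y∈ρ' , refl))
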